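{- Let $G=(V,E)$ be a $uv$-sparse graph, where $u,v\in V$ are distinct, and suppose there are vertices $a,b$ such that $a,u,b,v$ is a cycle in $G$. Let $G'$ be the graph obtained from $G$ by identifying $u$ and $v$ into a single vertex $z$, where the edges $au,av$ become the single edge $az$, the edges $bu,bv$ become the single edge $bz$, and every other edge with an end in $\{u,v\}$ has that end replaced by $z$. Then $G'$ is a simple graph which is $(2,2)$-sparse.
   Context: A graph is $(2,2)$-sparse if every subgraph $(V',E')$ satisfies $|E'|\le2|V'|-2$. $i(X)$ counts edges with both ends in $X\subseteq V$; for a family $\mathcal{H}=\{H_1,\dots,H_k\}$, $i(\mathcal{H})$ counts edges with both ends in some $H_j$. For nonempty $H\subseteq V$, $\mathrm{val}(H)=2|H|-t_H$ with $t_H=4$ if $H=\{u,v\}$, $t_H=3$ if $H\ne\{u,v\}$ and $|H|\in\{2,3\}$, $t_H=2$ otherwise. $\mathcal{H}$ is $uv$-compatible if $u,v\in H_j$ and $|H_j|\ge3$ for all $j$, with $\mathrm{val}(\mathcal{H})=\sum_j\mathrm{val}(H_j)-2(k-1)$. $G$ is $uv$-sparse if $i(H)\le\mathrm{val}(H)$ for all $H\subseteq V$ with $|H|\ge2$ and $i(\mathcal{H})\le\mathrm{val}(\mathcal{H})$ for all $uv$-compatible $\mathcal{H}$. -}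

module Defs where

open import Data.Nat using (ℕ; zero; suc; _+_; _*_; _∸_; _≤_; _≡ᵇ_)
open import Data.Bool using (Bool; true; false; _∧_; _∨_; not; if_then_else_)
open import Data.Fin using (Fin; punchOut)
open import Data.Fin.Properties using (_≟_)
open import Data.Fin.Subset using (Subset; ∣_∣; ⁅_⁆; _∪_; Nonempty; _∈_)
open import Data.Vec using (lookup)
open import Data.Vec.Properties using (≡-dec)
import Data.Bool.Properties as BoolP
open import Data.List using (List; []; _∷_; length; filterᵇ; map)
open import Data.Bool.ListAction using (any)
open import Data.Nat.ListAction using (sum)
open import Data.List.Relation.Unary.All using (All)
open import Data.List.Relation.Unary.AllPairs using (AllPairs)
open import Data.List.Relation.Binary.Sublist.Propositional using (_⊆_)
open import Data.List.Membership.Propositional renaming (_∈_ to _∈ₗ_)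
open import Data.Product using (_×_; _,_)
open import Data.Sum using (_⊎_)
open import Relation.Nullary using (¬_; does)
open import Relation.Binary.PropositionalEquality using (_≡_; _≢_)

-- A (multi)graph on vertex set Fin n is given by its list of edges;
-- an edge (x , y) is an unordered pair {x , y}.
Edge : ℕ → Set
Edge n = Fin n × Fin n

EdgeList : ℕ → Set
EdgeList n = List (Edge n)

Loopless : ∀ {n} → EdgeList n → Set
Loopless E = All (λ { (x , y) → x ≢ y }) E

SameEdge : ∀ {n} → Edge n → Edge n → Set
SameEdge (x , y) (x' , y') = (x ≡ x' × y ≡ y') ⊎ (x ≡ y' × y ≡ x')

sameEdgeᵇ : ∀ {n} → Edge n → Edge n → Bool
sameEdgeᵇ (x , y) (x' , y') =
  (does (x ≟ x') ∧ does (y ≟ y')) ∨ (does (x ≟ y') ∧ does (y ≟ x'))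

Simple : ∀ {n} → EdgeList n → Set
Simple E = Loopless E × AllPairs (λ e f → ¬ SameEdge e f) E

HasEdge : ∀ {n} → EdgeList n → Fin n → Fin n → Set
HasEdge E x y = (x , y) ∈ₗ E ⊎ (y , x) ∈ₗ E

Sparse22 : ∀ {n} → EdgeList n → Set
Sparse22 {n} E =
  (V' : Subset n) (E' : EdgeList n) → Nonempty V' → E' ⊆ E →
  All (λ { (x , y) → x ∈ V' × y ∈ V' }) E' →
  length E' + 2 ≤ 2 * ∣ V' ∣

iSet : ∀ {n} → EdgeList n → Subset n → ℕ
iSet E X = length (filterᵇ (λ { (x , y) → lookup X x ∧ lookup X y }) E)

iFam : ∀ {n} → EdgeList n → List (Subset n) → ℕ
iFam E 𝓗 =
  length (filterᵇ (λ { (x , y) → any (λ H → lookup H x ∧ lookup H y) 𝓗 }) E)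

tH : ∀ {n} → Fin n → Fin n → Subset n → ℕ
tH u v H =
  if does (≡-dec BoolP._≟_ H (⁅ u ⁆ ∪ ⁅ v ⁆)) then 4
  else (if (∣ H ∣ ≡ᵇ 2) ∨ (∣ H ∣ ≡ᵇ 3) then 3 else 2)

-- val(H) = 2|H| - t_H  (only used for |H| ≥ 3, where it is exact in ℕ)
valH : ∀ {n} → Fin n → Fin n → Subset n → ℕ
valH u v H = 2 * ∣ H ∣ ∸ tH u v H

Compatible : ∀ {n} → Fin n → Fin n → List (Subset n) → Set
Compatible u v 𝓗 = All (λ H → u ∈ H × v ∈ H × 3 ≤ ∣ H ∣) 𝓗

-- uv-sparse.  i(H) ≤ val(H) is written i(H) + t_H ≤ 2|H|, and
-- i(𝓗) ≤ Σ val(H_j) - 2(k-1) is written i(𝓗) + 2k ≤ Σ val(H_j) + 2.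
UVSparse : ∀ {n} → Fin n → Fin n → EdgeList n → Set
UVSparse {n} u v E =
  ((H : Subset n) → 2 ≤ ∣ H ∣ → iSet E H + tH u v H ≤ 2 * ∣ H ∣)
  × ((𝓗 : List (Subset n)) → Compatible u v 𝓗 →
       iFam E 𝓗 + 2 * length 𝓗 ≤ sum (map (valH u v) 𝓗) + 2)

Cycle4 : ∀ {n} → EdgeList n → Fin n → Fin n → Fin n → Fin n → Set
Cycle4 E a u b v =
  (a ≢ u × a ≢ b × a ≢ v × u ≢ b × u ≢ v × b ≢ v)
  × (HasEdge E a u × HasEdge E u b × HasEdge E b v × HasEdge E v a)

-- Identification of u and v: the vertex set of G' is Fin n (v is deleted,
-- the remaining vertices renumbered by punchOut); z = merge u = merge v.
mergeV : ∀ {n} {u v : Fin (suc n)} → u ≢ v → Fin (suc n) → Fin n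
mergeV {v = v} u≢v x with v ≟ x
... | Relation.Nullary.yes _ = punchOut (λ eq → u≢v (Relation.Binary.PropositionalEquality.sym eq))
... | Relation.Nullary.no v≢x = punchOut v≢x

-- edges of G': drop the edges av and bv (so au,av give the single edge az,
-- bu,bv the single edge bz), and replace the ends u, v of all other edges by z.
mergeE : ∀ {n} (u v a b : Fin (suc n)) → u ≢ v → EdgeList (suc n) → EdgeList n
mergeE u v a b u≢v E =
  map (λ { (x , y) → mergeV u≢v x , mergeV u≢v y })
      (filterᵇ (λ e → not (sameEdgeᵇ e (a , v) ∨ sameEdgeᵇ e (b , v))) E)

-- Write z for the merged vertex. A vertex set V' of G' pulls back to a set X of G: X = V' when
-- z ∉ V', and otherwise X is V' with z replaced by u and v, so |X| = |V'| + 1. The edges of G'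
-- inside V' are the edges of G inside X except the deleted copies av and bv. When z ∉ V',
-- uv-sparsity of X bounds them directly. When z ∈ V' two more units are needed, one for each
-- of a and b: a vertex of X among them has its deleted edge to v counted in i(X), and a vertex
-- w outside X gives a triangle {w, u, v} which, added to X in a uv-compatible family, improves
-- the bound on i(X) by one. As t_H = 3 when |H| ∈ {2, 3}, the same argument gives i ≤ 1 on
-- pairs of G', so G' has no parallel edges; and t = 4 on {u, v} excludes the edge uv, the only
-- possible source of a loop.
module Submission where

open import Defs
open import Data.Bool using (Bool; true; false; T; not; _∧_; _∨_; if_then_else_)
open import Data.Bool.Properties using (∧-comm; ∨-comm; ∨-identityʳ; T-≡)
import Data.Bool.Properties as Bool
open import Data.Bool.ListAction using (any)
open import Data.Empty using (⊥-elim)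
open import Data.Fin using (Fin; zero; suc; punchOut; punchIn)
open import Data.Fin.Properties using (_≟_; punchOut-cong; punchOut-injective; punchIn-punchOut)
open import Data.Fin.Subset using (Subset; ∣_∣; ⁅_⁆; _∪_; _∈_; _∉_)
open import Data.Fin.Subset.Properties
  using (x∈p∧x≢y⇒x∈p-y; x∈p⇒∣p-x∣<∣p∣; ∣⁅x⁆∣≡1; x∈p∪q⁺; x∈⁅x⁆)
open import Data.List using (List; []; _∷_; length; filterᵇ; map)
open import Data.List.Properties using (filter-all; filter-≐; length-map)
open import Data.List.Membership.Propositional using (lose) renaming (_∈_ to _∈ₗ_)
open import Data.List.Membership.Propositional.Properties using (∈-filter⁺; ∈-map⁺)
open import Data.List.Relation.Binary.Sublist.Propositional using (_⊆_; _∷_; _∷ʳ_; from∈; ⊆-refl)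
open import Data.List.Relation.Binary.Sublist.Propositional.Properties
  using (filter⁺; filter-⊆; length-mono-≤; All-resp-⊆)
open import Data.List.Relation.Unary.All as All using (All; []; _∷_)
import Data.List.Relation.Unary.All.Properties as All
open import Data.List.Relation.Unary.AllPairs as AllPairs using (AllPairs; []; _∷_)
import Data.List.Relation.Unary.AllPairs.Properties as AllPairs
open import Data.List.Relation.Unary.Any using (here; there)
open import Data.List.Relation.Unary.Any.Properties using (any⁺)
open import Data.List.Relation.Unary.Unique.Propositional using (Unique)
open import Data.Nat using (ℕ; suc; _+_; _*_; _∸_; _≤_; z≤n; s≤s; _≡ᵇ_)
open import Data.Nat.ListAction using (sum)
open import Data.Nat.Properties
  using (+-suc; +-mono-≤; ≤-trans; ≤-reflexive; module ≤-Reasoning; m≤n⇒m≤1+n; ≤-antisym; m∸n+n≡m; *-monoʳ-≤; ∸-monoʳ-≤; +-cancelʳ-≤; +-assoc; +-cancelˡ-≤; +-comm; *-suc; +-monoˡ-≤; +-monoʳ-≤; ≤-refl; <-irrefl; n≤1+n)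
open import Data.Nat.Tactic.RingSolver using (solve-∀)
open import Data.Product using (_×_; _,_; proj₁; proj₂)
open import Data.Sum using (_⊎_; inj₁; inj₂; [_,_]′)
import Data.Sum as Sum
open import Data.Unit using (tt)
open import Data.Vec using ([]; _∷_; lookup; insertAt)
open import Data.Vec.Properties
  using ([]=⇒lookup; lookup⇒[]=; ≡-dec; insertAt-lookup; insertAt-punchIn)
open import Function using (_∘_; id)
open import Function.Bundles using (Equivalence)
open import Relation.Nullary using (¬_; Dec; does; yes; no)
open import Relation.Nullary.Decidable using (_×-dec_; _⊎-dec_; dec-true; dec-false; T?)
open import Relation.Binary.PropositionalEquality

count : {A : Set} → (A → Bool) → List A → ℕ
count p xs = length (filterᵇ p xs)

module _ {A : Set} where

  count-partition : (p q : A → Bool) (xs : List A) →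
    count p xs ≡ count p (filterᵇ q xs) + count p (filterᵇ (not ∘ q) xs)
  count-partition p q [] = refl
  count-partition p q (x ∷ xs) with q x
  ... | true with p x
  ...   | true  = cong suc (count-partition p q xs)
  ...   | false = count-partition p q xs
  count-partition p q (x ∷ xs) | false with p x
  ...   | true  = trans (cong suc (count-partition p q xs)) (sym (+-suc _ _))
  ...   | false = count-partition p q xs

  count+count-not : (q : A → Bool) (xs : List A) → count q xs + count (not ∘ q) xs ≡ length xs
  count+count-not q [] = refl
  count+count-not q (x ∷ xs) with q x
  ... | true  = cong suc (count+count-not q xs)
  ... | false = trans (+-suc _ _) (cong suc (count+count-not q xs))

  count-mono : {p q : A → Bool} {xs ys : List A} →
    (∀ {x} → T (p x) → T (q x)) → xs ⊆ ys → count p xs ≤ count q ys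
  count-mono {p} {q} p⇒q xs⊆ys =
    length-mono-≤ (filter⁺ (T? ∘ p) (T? ∘ q) (λ { refl → p⇒q }) xs⊆ys)

  length≤count : {p : A → Bool} {xs ys : List A} →
    xs ⊆ ys → All (T ∘ p) xs → length xs ≤ count p ys
  length≤count {p} {xs} {ys} xs⊆ys pxs =
    subst (_≤ count p ys) (cong length (filter-all (T? ∘ p) pxs)) (count-mono id xs⊆ys)

  filterᵇ-cong : {p q : A → Bool} → (∀ x → p x ≡ q x) → (xs : List A) → filterᵇ p xs ≡ filterᵇ q xs
  filterᵇ-cong p≗q = filter-≐ _ _ ((λ {x} → subst T (p≗q x)) , (λ {x} → subst T (sym (p≗q x))))

  count-cong : {p q : A → Bool} → (∀ x → p x ≡ q x) → (xs : List A) → count p xs ≡ count q xs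
  count-cong p≗q xs = cong length (filterᵇ-cong p≗q xs)

  count-map : {B : Set} (p : B → Bool) (g : A → B) (xs : List A) →
    count p (map g xs) ≡ count (p ∘ g) xs
  count-map p g [] = refl
  count-map p g (x ∷ xs) with p (g x)
  ... | true  = cong suc (count-map p g xs)
  ... | false = count-map p g xs

  AllPairs-from-sublists : {R : A → A → Set} {xs : List A} →
    (∀ {x y} → x ∷ y ∷ [] ⊆ xs → R x y) → AllPairs R xs
  AllPairs-from-sublists {xs = []} _ = []
  AllPairs-from-sublists {xs = x ∷ xs} pairs =
    All.tabulate (λ y∈xs → pairs (refl ∷ from∈ y∈xs)) ∷ AllPairs-from-sublists (pairs ∘ (x ∷ʳ_))

  sum-map≤ : {f : A → ℕ} {c : ℕ} {xs : List A} →
    All (λ x → f x ≤ c) xs → sum (map f xs) ≤ length xs * c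
  sum-map≤ [] = z≤n
  sum-map≤ (fx≤c ∷ fxs≤c) = +-mono-≤ fx≤c (sum-map≤ fxs≤c)

module _ {n : ℕ} where

  sameEdge? : (e f : Edge n) → Dec (SameEdge e f)
  sameEdge? (x , y) (x' , y') = (x ≟ x' ×-dec y ≟ y') ⊎-dec (x ≟ y' ×-dec y ≟ x')

  sameEdgeᵇ⁺ : {e f : Edge n} → SameEdge e f → T (sameEdgeᵇ e f)
  sameEdgeᵇ⁺ {e} {f} e∼f = subst T (sym (dec-true (sameEdge? e f) e∼f)) tt

  sameEdgeᵇ⁻ : {e f : Edge n} → ¬ SameEdge e f → T (not (sameEdgeᵇ e f))
  sameEdgeᵇ⁻ {e} {f} e≁f = subst (T ∘ not) (sym (dec-false (sameEdge? e f) e≁f)) tt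

  SameEdge-sym : {e f : Edge n} → SameEdge e f → SameEdge f e
  SameEdge-sym (inj₁ (x≡x' , y≡y')) = inj₁ (sym x≡x' , sym y≡y')
  SameEdge-sym (inj₂ (x≡y' , y≡x')) = inj₂ (sym y≡x' , sym x≡y')

  ¬SameEdge : {x y x' y' : Fin n} → x ≢ x' ⊎ y ≢ y' → x ≢ y' → ¬ SameEdge (x , y) (x' , y')
  ¬SameEdge (inj₁ x≢x') _ (inj₁ (x≡x' , _)) = x≢x' x≡x'
  ¬SameEdge (inj₂ y≢y') _ (inj₁ (_ , y≡y')) = y≢y' y≡y'
  ¬SameEdge _ x≢y' (inj₂ (x≡y' , _)) = x≢y' x≡y'

  ¬SameEdge-fan : {x x' y : Fin n} → x ≢ x' → ¬ SameEdge (x , y) (x' , y)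
  ¬SameEdge-fan x≢x' (inj₁ (x≡x' , _)) = x≢x' x≡x'
  ¬SameEdge-fan x≢x' (inj₂ (x≡y , y≡x')) = x≢x' (trans x≡y y≡x')

  Undirected : (Edge n → Bool) → Set
  Undirected p = ∀ x y → p (x , y) ≡ p (y , x)

  sameEdgeᵇ-undirected : (f : Edge n) → Undirected (λ e → sameEdgeᵇ e f)
  sameEdgeᵇ-undirected (x' , y') x y =
    trans (∨-comm (does (x ≟ x') ∧ does (y ≟ y')) _)
          (cong₂ _∨_ (∧-comm (does (x ≟ y')) _) (∧-comm (does (x ≟ x')) _))

  any-undirected : {A : Set} (f : A → Edge n → Bool) → (∀ c → Undirected (f c)) →
    (cs : List A) → Undirected (λ e → any (λ c → f c e) cs)
  any-undirected f f-und [] x y = refl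
  any-undirected f f-und (c ∷ cs) x y = cong₂ _∨_ (f-und c x y) (any-undirected f f-und cs x y)

  module _ {p : Edge n → Bool} (p-undirected : Undirected p) {L : EdgeList n} {x y : Fin n} where

    HasEdge-filter : HasEdge L x y → T (p (x , y)) → HasEdge (filterᵇ p L) x y
    HasEdge-filter (inj₁ xy∈L) pxy = inj₁ (∈-filter⁺ (T? ∘ p) xy∈L pxy)
    HasEdge-filter (inj₂ yx∈L) pxy =
      inj₂ (∈-filter⁺ (T? ∘ p) yx∈L (subst T (p-undirected x y) pxy))

    HasEdge⇒1≤count : HasEdge L x y → T (p (x , y)) → 1 ≤ count p L
    HasEdge⇒1≤count (inj₁ xy∈L) pxy = length≤count (from∈ xy∈L) (pxy ∷ [])
    HasEdge⇒1≤count (inj₂ yx∈L) pxy =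
      length≤count (from∈ yx∈L) (subst T (p-undirected x y) pxy ∷ [])

  Distinct : EdgeList n → Set
  Distinct = AllPairs (λ e f → ¬ SameEdge e f)

  HasEdgeWith : EdgeList n → (Edge n → Bool) → Edge n → Set
  HasEdgeWith L p (x , y) = HasEdge L x y × T (p (x , y))

  distinct≤count : {p : Edge n → Bool} → Undirected p → {L : EdgeList n} (ts : EdgeList n) →
    Distinct ts → All (HasEdgeWith L p) ts → length ts ≤ count p L
  distinct≤count p-und [] _ _ = z≤n
  distinct≤count {p} p-und {L} (t@(x , y) ∷ ts) (t≁ts ∷ ts-distinct) ((xy∈L , pxy) ∷ ts∈L) =
    begin
      1 + length ts
        ≤⟨ +-mono-≤ (HasEdge⇒1≤count p-und (HasEdge-filter q-und xy∈L (sameEdgeᵇ⁺ t∼t)) pxy)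
                    (distinct≤count p-und ts ts-distinct (All.zipWith survives (t≁ts , ts∈L))) ⟩
      count p (filterᵇ q L) + count p (filterᵇ (not ∘ q) L)
        ≡⟨ count-partition p q L ⟨
      count p L
    ∎
    where
    open ≤-Reasoning
    q : Edge n → Bool
    q e = sameEdgeᵇ e t
    q-und : Undirected q
    q-und = sameEdgeᵇ-undirected t
    t∼t : SameEdge t t
    t∼t = inj₁ (refl , refl)
    survives : {s : Edge n} → ¬ SameEdge t s × HasEdgeWith L p s →
      HasEdgeWith (filterᵇ (not ∘ q) L) p s
    survives (t≁s , s∈L , ps) =
      HasEdge-filter (λ x' y' → cong not (q-und x' y')) s∈L (sameEdgeᵇ⁻ (t≁s ∘ SameEdge-sym)) , ps

  -- By definition, iSet E H = count (within H) E and iFam E 𝓗 = count (withinSome 𝓗) E.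
  within : Subset n → Edge n → Bool
  within H (x , y) = lookup H x ∧ lookup H y

  withinSome : List (Subset n) → Edge n → Bool
  withinSome 𝓗 e = any (λ H → within H e) 𝓗

  within⁺ : {x y : Fin n} {H : Subset n} → x ∈ H → y ∈ H → T (within H (x , y))
  within⁺ x∈H y∈H rewrite []=⇒lookup x∈H | []=⇒lookup y∈H = tt

  ∉⇒¬within : {x y : Fin n} {H : Subset n} → x ∉ H → T (not (within H (x , y)))
  ∉⇒¬within {x} {H = H} x∉H with lookup H x in eq
  ... | true  = ⊥-elim (x∉H (lookup⇒[]= x H eq))
  ... | false = tt

  within-undirected : (H : Subset n) → Undirected (within H)
  within-undirected H x y = ∧-comm (lookup H x) (lookup H y)

  withinSome⁺ : {𝓗 : List (Subset n)} {H : Subset n} {e : Edge n} →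
    H ∈ₗ 𝓗 → T (within H e) → T (withinSome 𝓗 e)
  withinSome⁺ {e = e} H∈𝓗 e⊆H = any⁺ (λ H → within H e) (lose H∈𝓗 e⊆H)

  within-pair : {x y : Fin n} {e : Edge n} → SameEdge e (x , y) → T (within (⁅ x ⁆ ∪ ⁅ y ⁆) e)
  within-pair {x} {y} (inj₁ (refl , refl)) = within⁺ (x∈p∪q⁺ (inj₁ (x∈⁅x⁆ x))) (x∈p∪q⁺ (inj₂ (x∈⁅x⁆ y)))
  within-pair {x} {y} (inj₂ (refl , refl)) = within⁺ (x∈p∪q⁺ (inj₂ (x∈⁅x⁆ y))) (x∈p∪q⁺ (inj₁ (x∈⁅x⁆ x)))

module _ {n : ℕ} where

  x∈p⇒1≤∣p∣ : {x : Fin n} {p : Subset n} → x ∈ p → 1 ≤ ∣ p ∣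
  x∈p⇒1≤∣p∣ x∈p = ≤-trans (s≤s z≤n) (x∈p⇒∣p-x∣<∣p∣ x∈p)

  x,y∈p⇒2≤∣p∣ : {x y : Fin n} {p : Subset n} → x ≢ y → x ∈ p → y ∈ p → 2 ≤ ∣ p ∣
  x,y∈p⇒2≤∣p∣ x≢y x∈p y∈p =
    ≤-trans (s≤s (x∈p⇒1≤∣p∣ (x∈p∧x≢y⇒x∈p-y y∈p (x≢y ∘ sym)))) (x∈p⇒∣p-x∣<∣p∣ x∈p)

  x,y,z∈p⇒3≤∣p∣ : {x y z : Fin n} {p : Subset n} → x ≢ y → x ≢ z → y ≢ z →
    x ∈ p → y ∈ p → z ∈ p → 3 ≤ ∣ p ∣
  x,y,z∈p⇒3≤∣p∣ x≢y x≢z y≢z x∈p y∈p z∈p =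
    ≤-trans (s≤s (x,y∈p⇒2≤∣p∣ y≢z (x∈p∧x≢y⇒x∈p-y y∈p (x≢y ∘ sym))
                                   (x∈p∧x≢y⇒x∈p-y z∈p (x≢z ∘ sym))))
            (x∈p⇒∣p-x∣<∣p∣ x∈p)

  T-lookup⇒∈ : {x : Fin n} {p : Subset n} → T (lookup p x) → x ∈ p
  T-lookup⇒∈ {x} {p} t = lookup⇒[]= x p (Equivalence.to T-≡ t)

  T-not-lookup⇒∉ : {x : Fin n} {p : Subset n} → T (not (lookup p x)) → x ∉ p
  T-not-lookup⇒∉ t x∈p = subst (T ∘ not) ([]=⇒lookup x∈p) t

  ∉∧∈⇒≢ : {x y : Fin n} {p : Subset n} → x ∉ p → y ∈ p → x ≢ y
  ∉∧∈⇒≢ x∉p y∈p refl = x∉p y∈p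

∣p∪q∣≤∣p∣+∣q∣ : ∀ {n} (p q : Subset n) → ∣ p ∪ q ∣ ≤ ∣ p ∣ + ∣ q ∣
∣p∪q∣≤∣p∣+∣q∣ [] [] = z≤n
∣p∪q∣≤∣p∣+∣q∣ (true ∷ p) (true ∷ q) =
  s≤s (≤-trans (m≤n⇒m≤1+n (∣p∪q∣≤∣p∣+∣q∣ p q)) (≤-reflexive (sym (+-suc _ _))))
∣p∪q∣≤∣p∣+∣q∣ (true ∷ p) (false ∷ q) = s≤s (∣p∪q∣≤∣p∣+∣q∣ p q)
∣p∪q∣≤∣p∣+∣q∣ (false ∷ p) (true ∷ q) =
  ≤-trans (s≤s (∣p∪q∣≤∣p∣+∣q∣ p q)) (≤-reflexive (sym (+-suc _ _)))
∣p∪q∣≤∣p∣+∣q∣ (false ∷ p) (false ∷ q) = ∣p∪q∣≤∣p∣+∣q∣ p q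

∣⁅x⁆∪⁅y⁆∣≡2 : ∀ {n} {x y : Fin n} → x ≢ y → ∣ ⁅ x ⁆ ∪ ⁅ y ⁆ ∣ ≡ 2
∣⁅x⁆∪⁅y⁆∣≡2 {x = x} {y} x≢y = ≤-antisym
  (≤-trans (∣p∪q∣≤∣p∣+∣q∣ ⁅ x ⁆ ⁅ y ⁆) (≤-reflexive (cong₂ _+_ (∣⁅x⁆∣≡1 x) (∣⁅x⁆∣≡1 y))))
  (x,y∈p⇒2≤∣p∣ x≢y (x∈p∪q⁺ (inj₁ (x∈⁅x⁆ x))) (x∈p∪q⁺ (inj₂ (x∈⁅x⁆ y))))

∣insertAt∣ : ∀ {n} (p : Subset n) (i : Fin (suc n)) (b : Bool) →
  ∣ insertAt p i b ∣ ≡ (if b then suc ∣ p ∣ else ∣ p ∣)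
∣insertAt∣ p zero true = refl
∣insertAt∣ p zero false = refl
∣insertAt∣ (true ∷ p) (suc i) true = cong suc (∣insertAt∣ p i true)
∣insertAt∣ (true ∷ p) (suc i) false = cong suc (∣insertAt∣ p i false)
∣insertAt∣ (false ∷ p) (suc i) b = ∣insertAt∣ p i b

module _ {n : ℕ} (u v : Fin n) (H : Subset n) where

  tH≥2 : 2 ≤ tH u v H
  tH≥2 with does (≡-dec Bool._≟_ H (⁅ u ⁆ ∪ ⁅ v ⁆))
  ... | true = s≤s (s≤s z≤n)
  ... | false with (∣ H ∣ ≡ᵇ 2) ∨ (∣ H ∣ ≡ᵇ 3)
  ...   | true  = s≤s (s≤s z≤n)
  ...   | false = ≤-refl

  tH≤4 : tH u v H ≤ 4
  tH≤4 with does (≡-dec Bool._≟_ H (⁅ u ⁆ ∪ ⁅ v ⁆))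
  ... | true = ≤-refl
  ... | false with (∣ H ∣ ≡ᵇ 2) ∨ (∣ H ∣ ≡ᵇ 3)
  ...   | true  = s≤s (s≤s (s≤s z≤n))
  ...   | false = s≤s (s≤s z≤n)

  tH≥3 : ∣ H ∣ ≡ 2 ⊎ ∣ H ∣ ≡ 3 → 3 ≤ tH u v H
  tH≥3 size with does (≡-dec Bool._≟_ H (⁅ u ⁆ ∪ ⁅ v ⁆))
  ... | true = s≤s (s≤s (s≤s z≤n))
  tH≥3 (inj₁ ∣H∣≡2) | false rewrite ∣H∣≡2 = ≤-refl
  tH≥3 (inj₂ ∣H∣≡3) | false rewrite ∣H∣≡3 = ≤-refl

  valH+tH≡2∣H∣ : 2 ≤ ∣ H ∣ → valH u v H + tH u v H ≡ 2 * ∣ H ∣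
  valH+tH≡2∣H∣ 2≤∣H∣ = m∸n+n≡m (≤-trans tH≤4 (*-monoʳ-≤ 2 2≤∣H∣))

tH-pair : ∀ {n} (u v : Fin n) → tH u v (⁅ u ⁆ ∪ ⁅ v ⁆) ≡ 4
tH-pair u v rewrite dec-true (≡-dec Bool._≟_ (⁅ u ⁆ ∪ ⁅ v ⁆) (⁅ u ⁆ ∪ ⁅ v ⁆)) refl = refl

-- The t-value of (2,2)-sparsity, raised to 3 on pairs so that it also forbids parallel edges.
t′ : ℕ → ℕ
t′ 2 = 3
t′ _ = 2

t′≥2 : ∀ m → 2 ≤ t′ m
t′≥2 0 = ≤-refl
t′≥2 1 = ≤-refl
t′≥2 2 = s≤s (s≤s z≤n)
t′≥2 (suc (suc (suc _))) = ≤-refl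

t′≤tH : ∀ {n} (u v : Fin n) (H : Subset n) m → ∣ H ∣ ≡ m ⊎ ∣ H ∣ ≡ suc m → t′ m ≤ tH u v H
t′≤tH u v H 0 _ = tH≥2 u v H
t′≤tH u v H 1 _ = tH≥2 u v H
t′≤tH u v H 2 size = tH≥3 u v H size
t′≤tH u v H (suc (suc (suc _))) _ = tH≥2 u v H

-- Triangles on u and v

cancel-triangles : ∀ i k w → i + k * 2 + 2 * suc k ≤ w + k * 3 + 2 → i + k ≤ w
cancel-triangles i k w h =
  +-cancelʳ-≤ (k * 3 + 2) (i + k) w (subst₂ _≤_ (regroup i k) (+-assoc w (k * 3) 2) h)
  where
  regroup : ∀ i k → i + k * 2 + 2 * suc k ≡ i + k + (k * 3 + 2)
  regroup = solve-∀

module _ {n : ℕ} {u v : Fin n} (u≢v : u ≢ v) where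

  triangle : Fin n → Subset n
  triangle w = ⁅ w ⁆ ∪ (⁅ u ⁆ ∪ ⁅ v ⁆)

  module _ (w : Fin n) where

    w∈triangle : w ∈ triangle w
    w∈triangle = x∈p∪q⁺ (inj₁ (x∈⁅x⁆ w))

    u∈triangle : u ∈ triangle w
    u∈triangle = x∈p∪q⁺ (inj₂ (x∈p∪q⁺ (inj₁ (x∈⁅x⁆ u))))

    v∈triangle : v ∈ triangle w
    v∈triangle = x∈p∪q⁺ (inj₂ (x∈p∪q⁺ (inj₂ (x∈⁅x⁆ v))))

  module _ {w : Fin n} (w≢u : w ≢ u) (w≢v : w ≢ v) where

    ∣triangle∣≡3 : ∣ triangle w ∣ ≡ 3
    ∣triangle∣≡3 = ≤-antisym
      (≤-trans (∣p∪q∣≤∣p∣+∣q∣ ⁅ w ⁆ _)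
        (+-mono-≤ (≤-reflexive (∣⁅x⁆∣≡1 w)) (≤-reflexive (∣⁅x⁆∪⁅y⁆∣≡2 u≢v))))
      (x,y,z∈p⇒3≤∣p∣ w≢u w≢v u≢v (w∈triangle w) (u∈triangle w) (v∈triangle w))

    valH-triangle≤3 : valH u v (triangle w) ≤ 3
    valH-triangle≤3 = begin
      2 * ∣ triangle w ∣ ∸ tH u v (triangle w)
        ≤⟨ ∸-monoʳ-≤ _ (tH≥3 u v (triangle w) (inj₂ ∣triangle∣≡3)) ⟩
      2 * ∣ triangle w ∣ ∸ 3
        ≡⟨ cong (λ m → 2 * m ∸ 3) ∣triangle∣≡3 ⟩
      3 ∎
      where open ≤-Reasoning

  spokes : List (Fin n) → EdgeList n
  spokes [] = []
  spokes (w ∷ ws) = (w , u) ∷ (w , v) ∷ spokes ws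

  length-spokes : (ws : List (Fin n)) → length (spokes ws) ≡ length ws * 2
  length-spokes [] = refl
  length-spokes (w ∷ ws) = cong (2 +_) (length-spokes ws)

  All-spokes : {P : Edge n → Set} {ws : List (Fin n)} →
    All (λ w → P (w , u) × P (w , v)) ws → All P (spokes ws)
  All-spokes [] = []
  All-spokes ((pu , pv) ∷ pws) = pu ∷ pv ∷ All-spokes pws

  spokes-distinct : {ws : List (Fin n)} → Unique ws → All (λ w → w ≢ u × w ≢ v) ws →
    Distinct (spokes ws)
  spokes-distinct [] [] = []
  spokes-distinct {w ∷ ws} (w∉ws ∷ ws-unique) ((w≢u , w≢v) ∷ ws-off) =
    (¬SameEdge (inj₂ u≢v) w≢v ∷ apart) ∷ apart ∷ spokes-distinct ws-unique ws-off
    where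
    apart : ∀ {x} → All (λ f → ¬ SameEdge (w , x) f) (spokes ws)
    apart = All-spokes
      (All.map (λ w≢w' → ¬SameEdge (inj₁ w≢w') w≢u , ¬SameEdge (inj₁ w≢w') w≢v) w∉ws)

  joins : List (Fin n) → Edge n → Bool
  joins cs e = any (λ c → sameEdgeᵇ e (c , v)) cs

  module _ {E : EdgeList n} (sparse : UVSparse u v E)
           {X : Subset n} (u∈X : u ∈ X) (v∈X : v ∈ X) (3≤∣X∣ : 3 ≤ ∣ X ∣) where

    -- A triangle {w, u, v} adds the two edges wu, wv to i(𝓗) but only val − 2 = 1 to val(𝓗),
    -- so uv-sparsity of X together with the triangles gains one per triangle.
    triangle-bound : (ws : List (Fin n)) → Unique ws →
      All (λ w → w ∉ X × HasEdge E w u × HasEdge E w v) ws →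
      iSet E X + length ws ≤ valH u v X
    triangle-bound ws ws-unique ws-spokes = cancel-triangles _ _ _ (begin
      iSet E X + length ws * 2 + 2 * suc (length ws)
        ≡⟨ cong (λ k → iSet E X + length ws * 2 + 2 * suc k) (length-map triangle ws) ⟨
      iSet E X + length ws * 2 + 2 * length 𝓗
        ≤⟨ +-monoˡ-≤ _ family-edges ⟩
      iFam E 𝓗 + 2 * length 𝓗
        ≤⟨ proj₂ sparse 𝓗 compatible ⟩
      valH u v X + sum (map (valH u v) (map triangle ws)) + 2
        ≤⟨ +-monoˡ-≤ 2 (+-monoʳ-≤ (valH u v X) triangles-val) ⟩
      valH u v X + length (map triangle ws) * 3 + 2
        ≡⟨ cong (λ k → valH u v X + k * 3 + 2) (length-map triangle ws) ⟩
      valH u v X + length ws * 3 + 2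
        ∎)
      where
      open ≤-Reasoning
      𝓗 : List (Subset n)
      𝓗 = X ∷ map triangle ws

      off-uv : All (λ w → w ≢ u × w ≢ v) ws
      off-uv = All.map (λ (w∉X , _) → ∉∧∈⇒≢ w∉X u∈X , ∉∧∈⇒≢ w∉X v∈X) ws-spokes

      compatible : Compatible u v 𝓗
      compatible = (u∈X , v∈X , 3≤∣X∣) ∷ All.map⁺ (All.map
        (λ {w} (w≢u , w≢v) → u∈triangle w , v∈triangle w , ≤-reflexive (sym (∣triangle∣≡3 w≢u w≢v)))
        off-uv)

      triangles-val : sum (map (valH u v) (map triangle ws)) ≤ length (map triangle ws) * 3
      triangles-val = sum-map≤ (All.map⁺ (All.map (λ (w≢u , w≢v) → valH-triangle≤3 w≢u w≢v) off-uv))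

      outside-undirected : Undirected (not ∘ within X)
      outside-undirected x y = cong not (within-undirected X x y)

      spokes-present : ∀ {w} → triangle w ∈ₗ 𝓗 × (w ∉ X × HasEdge E w u × HasEdge E w v) →
        HasEdgeWith (filterᵇ (not ∘ within X) E) (withinSome 𝓗) (w , u) ×
        HasEdgeWith (filterᵇ (not ∘ within X) E) (withinSome 𝓗) (w , v)
      spokes-present {w} (tri∈𝓗 , w∉X , wu , wv) =
        (HasEdge-filter outside-undirected wu (∉⇒¬within w∉X) ,
         withinSome⁺ tri∈𝓗 (within⁺ (w∈triangle w) (u∈triangle w))) ,
        (HasEdge-filter outside-undirected wv (∉⇒¬within w∉X) ,
         withinSome⁺ tri∈𝓗 (within⁺ (w∈triangle w) (v∈triangle w)))

      family-edges : iSet E X + length ws * 2 ≤ iFam E 𝓗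
      family-edges = begin
        iSet E X + length ws * 2
          ≡⟨ cong (iSet E X +_) (length-spokes ws) ⟨
        iSet E X + length (spokes ws)
          ≤⟨ +-mono-≤
               (length≤count ⊆-refl (All.map (λ {e} → withinSome⁺ {𝓗 = 𝓗} {e = e} (here refl))
                                               (All.all-filter (T? ∘ within X) E)))
               (distinct≤count (any-undirected within within-undirected 𝓗) (spokes ws)
                  (spokes-distinct ws-unique off-uv)
                  (All-spokes (All.zipWith spokes-present
                                 (All.tabulate (there ∘ ∈-map⁺ triangle) , ws-spokes)))) ⟩
        count (withinSome 𝓗) (filterᵇ (within X) E) +
        count (withinSome 𝓗) (filterᵇ (not ∘ within X) E)
          ≡⟨ count-partition (withinSome 𝓗) (within X) E ⟨
        iFam E 𝓗
          ∎

    -- Each c ∈ cs either lies in X, and then the deleted edge cv was counted in i(X),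
    -- or lies outside X, and then it contributes a triangle.
    surviving-bound : (cs : List (Fin n)) → Unique cs →
      All (λ c → HasEdge E c u × HasEdge E c v) cs →
      count (within X) (filterᵇ (not ∘ joins cs) E) + length cs ≤ valH u v X
    surviving-bound cs cs-unique cs-common = begin
      survivors + length cs                ≡⟨ cong (survivors +_) (count+count-not (lookup X) cs) ⟨
      survivors + (length ds + length ws)  ≡⟨ +-assoc survivors _ _ ⟨
      survivors + length ds + length ws    ≤⟨ +-monoˡ-≤ _ deleted-edges ⟩
      iSet E X + length ws                 ≤⟨ triangle-bound ws (AllPairs.filter⁺ _ cs-unique) ws-spokes ⟩
      valH u v X                           ∎
      where
      open ≤-Reasoning
      survivors : ℕ
      survivors = count (within X) (filterᵇ (not ∘ joins cs) E)
      ds ws : List (Fin n)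
      ds = filterᵇ (lookup X) cs
      ws = filterᵇ (not ∘ lookup X) cs

      ws-spokes : All (λ w → w ∉ X × HasEdge E w u × HasEdge E w v) ws
      ws-spokes = All.zipWith (λ (w∉X , wu , wv) → T-not-lookup⇒∉ w∉X , wu , wv)
        (All.all-filter (T? ∘ not ∘ lookup X) cs , All.filter⁺ _ cs-common)

      joins-undirected : Undirected (joins cs)
      joins-undirected =
        any-undirected (λ c e → sameEdgeᵇ e (c , v)) (λ c → sameEdgeᵇ-undirected (c , v)) cs

      deleted-present : ∀ {d} → T (lookup X d) × d ∈ₗ cs × HasEdge E d u × HasEdge E d v →
        HasEdgeWith (filterᵇ (joins cs) E) (within X) (d , v)
      deleted-present {d} (d∈X , d∈cs , _ , dv) =
        HasEdge-filter joins-undirected dv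
          (any⁺ _ (lose d∈cs (sameEdgeᵇ⁺ {e = d , v} (inj₁ (refl , refl))))) ,
        within⁺ (T-lookup⇒∈ d∈X) v∈X

      deleted-edges : survivors + length ds ≤ iSet E X
      deleted-edges = begin
        survivors + length ds
          ≡⟨ cong (survivors +_) (length-map (_, v) ds) ⟨
        survivors + length (map (_, v) ds)
          ≤⟨ +-monoʳ-≤ survivors (distinct≤count (within-undirected X) (map (_, v) ds)
               (AllPairs.map⁺ (AllPairs.map ¬SameEdge-fan (AllPairs.filter⁺ _ cs-unique)))
               (All.map⁺ (All.zipWith deleted-present
                 (All.all-filter (T? ∘ lookup X) cs ,
                  All.filter⁺ _ (All.zip (All.tabulate id , cs-common)))))) ⟩
        survivors + count (within X) (filterᵇ (joins cs) E)
          ≡⟨ +-comm survivors _ ⟩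
        count (within X) (filterᵇ (joins cs) E) + survivors
          ≡⟨ count-partition (within X) (joins cs) E ⟨
        iSet E X
          ∎

-- Identifying u and v

module Merge {n : ℕ} {u v : Fin (suc n)} (u≢v : u ≢ v) where

  mergeV-off : {x : Fin (suc n)} (v≢x : v ≢ x) → mergeV u≢v x ≡ punchOut v≢x
  mergeV-off {x} v≢x with v ≟ x
  ... | yes v≡x = ⊥-elim (v≢x v≡x)
  ... | no _    = punchOut-cong v refl

  mergeV-v : mergeV u≢v v ≡ mergeV u≢v u
  mergeV-v with v ≟ v
  ... | yes _  = sym (mergeV-off (u≢v ∘ sym))
  ... | no v≢v = ⊥-elim (v≢v refl)

  mergeV-identifies : ∀ x y → mergeV u≢v x ≡ mergeV u≢v y → x ≡ y ⊎ SameEdge (x , y) (u , v)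
  mergeV-identifies x y eq with v ≟ x | v ≟ y
  ... | yes refl | yes refl = inj₁ refl
  ... | yes refl | no v≢y   = inj₂ (inj₂ (refl , sym (punchOut-injective _ v≢y eq)))
  ... | no v≢x   | yes refl = inj₂ (inj₁ (punchOut-injective v≢x _ eq , refl))
  ... | no v≢x   | no v≢y   = inj₁ (punchOut-injective v≢x v≢y eq)

  z : Fin n
  z = mergeV u≢v u

  preimage : Subset n → Subset (suc n)
  preimage V' = insertAt V' v (lookup V' z)

  lookup-preimage : (V' : Subset n) (x : Fin (suc n)) →
    lookup (preimage V') x ≡ lookup V' (mergeV u≢v x)
  lookup-preimage V' x with v ≟ x
  ... | yes refl = trans (insertAt-lookup V' v _) (cong (lookup V') (mergeV-off (u≢v ∘ sym)))
  ... | no v≢x   = begin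
    lookup (preimage V') x
      ≡⟨ cong (lookup (preimage V')) (punchIn-punchOut v≢x) ⟨
    lookup (preimage V') (punchIn v (punchOut v≢x))
      ≡⟨ insertAt-punchIn V' v _ (punchOut v≢x) ⟩
    lookup V' (punchOut v≢x) ∎
    where open ≡-Reasoning

  ∣preimage∣ : (V' : Subset n) → ∣ preimage V' ∣ ≡ (if lookup V' z then suc ∣ V' ∣ else ∣ V' ∣)
  ∣preimage∣ V' = ∣insertAt∣ V' v (lookup V' z)

cancel-merged-vertex : ∀ {k w s t m} → k + 2 ≤ w → s ≤ t → w + t ≡ 2 * suc m → k + s ≤ 2 * m
cancel-merged-vertex {k} {w} {s} {t} {m} k+2≤w s≤t w+t≡ = +-cancelˡ-≤ 2 (k + s) (2 * m) (begin
  2 + (k + s)  ≡⟨ trans (sym (+-assoc 2 k s)) (cong (_+ s) (+-comm 2 k)) ⟩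
  k + 2 + s    ≤⟨ +-mono-≤ k+2≤w s≤t ⟩
  w + t        ≡⟨ w+t≡ ⟩
  2 * suc m    ≡⟨ *-suc 2 m ⟩
  2 + 2 * m    ∎)
  where open ≤-Reasoning

module Contraction {n : ℕ} (E : EdgeList (suc n)) (u v a b : Fin (suc n)) (u≢v : u ≢ v)
  (loopless : Loopless E) (sparse : UVSparse u v E) (cycle : Cycle4 E a u b v) where

  open Merge u≢v

  E' : EdgeList n
  E' = mergeE u v a b u≢v E

  mergeEdge : Edge (suc n) → Edge n
  mergeEdge (x , y) = mergeV u≢v x , mergeV u≢v y

  keep : Edge (suc n) → Bool
  keep e = not (sameEdgeᵇ e (a , v) ∨ sameEdgeᵇ e (b , v))

  cs : List (Fin (suc n))
  cs = a ∷ b ∷ []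

  cs-unique : Unique cs
  cs-unique with proj₁ cycle
  ... | _ , a≢b , _ = (a≢b ∷ []) ∷ [] ∷ []

  cs-common : All (λ c → HasEdge E c u × HasEdge E c v) cs
  cs-common with proj₂ cycle
  ... | au , ub , bv , va = (au , Sum.swap va) ∷ (Sum.swap ub , bv) ∷ []

  count-E' : (V' : Subset n) →
    count (within V') E' ≡ count (within (preimage V')) (filterᵇ (not ∘ joins u≢v cs) E)
  count-E' V' = begin
    count (within V') (map mergeEdge (filterᵇ keep E))
      ≡⟨ count-map (within V') mergeEdge (filterᵇ keep E) ⟩
    count (within V' ∘ mergeEdge) (filterᵇ keep E)
      ≡⟨ count-cong (λ (x , y) → sym (cong₂ _∧_ (lookup-preimage V' x) (lookup-preimage V' y)))
                    (filterᵇ keep E) ⟩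
    count (within (preimage V')) (filterᵇ keep E)
      ≡⟨ cong (count (within (preimage V'))) (filterᵇ-cong keep-joins E) ⟩
    count (within (preimage V')) (filterᵇ (not ∘ joins u≢v cs) E)
      ∎
    where
    open ≡-Reasoning
    keep-joins : ∀ e → keep e ≡ not (joins u≢v cs e)
    keep-joins e = cong (λ t → not (sameEdgeᵇ e (a , v) ∨ t)) (sym (∨-identityʳ _))

  -- If z ∉ V' then V' is untouched by the merge; otherwise its preimage contains u and v
  -- and has one vertex more, which the two deleted edges or triangles at a and b pay for.
  merged-bound : (V' : Subset n) → 2 ≤ ∣ V' ∣ → count (within V') E' + t′ ∣ V' ∣ ≤ 2 * ∣ V' ∣
  merged-bound V' 2≤∣V'∣ with lookup V' z in z∈?V'
  ... | false = begin
    count (within V') E' + t′ ∣ V' ∣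
      ≡⟨ cong (_+ t′ ∣ V' ∣) (count-E' V') ⟩
    count (within X) (filterᵇ (not ∘ joins u≢v cs) E) + t′ ∣ V' ∣
      ≤⟨ +-mono-≤ (count-mono id (filter-⊆ (T? ∘ not ∘ joins u≢v cs) E))
                  (t′≤tH u v X _ (inj₁ ∣X∣≡∣V'∣)) ⟩
    iSet E X + tH u v X
      ≤⟨ proj₁ sparse X (subst (2 ≤_) (sym ∣X∣≡∣V'∣) 2≤∣V'∣) ⟩
    2 * ∣ X ∣
      ≡⟨ cong (2 *_) ∣X∣≡∣V'∣ ⟩
    2 * ∣ V' ∣
      ∎
    where
    open ≤-Reasoning
    X : Subset (suc n)
    X = preimage V'
    ∣X∣≡∣V'∣ : ∣ X ∣ ≡ ∣ V' ∣
    ∣X∣≡∣V'∣ = trans (∣preimage∣ V') (cong (λ c → if c then suc ∣ V' ∣ else ∣ V' ∣) z∈?V')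
  ... | true = cancel-merged-vertex
    (subst (λ k → k + 2 ≤ valH u v X) (sym (count-E' V'))
           (surviving-bound u≢v sparse u∈X v∈X 3≤∣X∣ cs cs-unique cs-common))
    (t′≤tH u v X _ (inj₂ ∣X∣≡1+∣V'∣))
    (trans (valH+tH≡2∣H∣ u v X (≤-trans (n≤1+n 2) 3≤∣X∣))
           (cong (2 *_) ∣X∣≡1+∣V'∣))
    where
    X : Subset (suc n)
    X = preimage V'
    ∣X∣≡1+∣V'∣ : ∣ X ∣ ≡ suc ∣ V' ∣
    ∣X∣≡1+∣V'∣ = trans (∣preimage∣ V') (cong (λ c → if c then suc ∣ V' ∣ else ∣ V' ∣) z∈?V')
    3≤∣X∣ : 3 ≤ ∣ X ∣
    3≤∣X∣ = subst (3 ≤_) (sym ∣X∣≡1+∣V'∣) (s≤s 2≤∣V'∣)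
    u∈X : u ∈ X
    u∈X = lookup⇒[]= u X (trans (lookup-preimage V' u) z∈?V')
    v∈X : v ∈ X
    v∈X = lookup⇒[]= v X (trans (lookup-preimage V' v) (trans (cong (lookup V') mergeV-v) z∈?V'))

  no-uv-edge : ∀ {e} → e ∈ₗ E → ¬ SameEdge e (u , v)
  no-uv-edge {e} e∈E e∼uv = <-irrefl refl (begin-strict
    4                    <⟨ +-monoˡ-≤ 4 (length≤count (from∈ e∈E) (within-pair e∼uv ∷ [])) ⟩
    iSet E P + 4         ≡⟨ cong (iSet E P +_) (tH-pair u v) ⟨
    iSet E P + tH u v P  ≤⟨ proj₁ sparse P (≤-reflexive (sym ∣P∣≡2)) ⟩
    2 * ∣ P ∣            ≡⟨ cong (2 *_) ∣P∣≡2 ⟩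
    4                    ∎)
    where
    open ≤-Reasoning
    P : Subset (suc n)
    P = ⁅ u ⁆ ∪ ⁅ v ⁆
    ∣P∣≡2 : ∣ P ∣ ≡ 2
    ∣P∣≡2 = ∣⁅x⁆∪⁅y⁆∣≡2 u≢v

  E'-loopless : Loopless E'
  E'-loopless = All.map⁺ (All.filter⁺ _ (All.tabulate merged-not-loop))
    where
    merged-not-loop : ∀ {e} → e ∈ₗ E → proj₁ (mergeEdge e) ≢ proj₂ (mergeEdge e)
    merged-not-loop {x , y} e∈E fx≡fy =
      [ All.lookup loopless e∈E , no-uv-edge e∈E ]′ (mergeV-identifies x y fx≡fy)

  E'-simple : Simple E'
  E'-simple = E'-loopless , AllPairs-from-sublists ¬parallel
    where
    ¬parallel : ∀ {e f} → e ∷ f ∷ [] ⊆ E' → ¬ SameEdge e f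
    ¬parallel {e@(p , q)} {f} ef⊆E' e∼f = <-irrefl refl (begin-strict
      4                               <⟨ +-monoˡ-≤ 3 (length≤count ef⊆E' (e∈P ∷ f∈P ∷ [])) ⟩
      count (within P) E' + 3         ≡⟨ cong (λ m → count (within P) E' + t′ m) ∣P∣≡2 ⟨
      count (within P) E' + t′ ∣ P ∣  ≤⟨ merged-bound P (≤-reflexive (sym ∣P∣≡2)) ⟩
      2 * ∣ P ∣                       ≡⟨ cong (2 *_) ∣P∣≡2 ⟩
      4                               ∎)
      where
      open ≤-Reasoning
      P : Subset n
      P = ⁅ p ⁆ ∪ ⁅ q ⁆
      ∣P∣≡2 : ∣ P ∣ ≡ 2
      ∣P∣≡2 = ∣⁅x⁆∪⁅y⁆∣≡2 (All.head (All-resp-⊆ ef⊆E' E'-loopless))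
      e∈P : T (within P e)
      e∈P = within-pair {e = e} (inj₁ (refl , refl))
      f∈P : T (within P f)
      f∈P = within-pair (SameEdge-sym e∼f)

  E'-sparse : Sparse22 E'
  E'-sparse V' [] (_ , x∈V') _ _ = *-monoʳ-≤ 2 (x∈p⇒1≤∣p∣ x∈V')
  E'-sparse V' F@(_ ∷ _) _ F⊆E' F⊆V'@((x∈V' , y∈V') ∷ _) = begin
    length F + 2
      ≤⟨ +-mono-≤ (length≤count F⊆E' (All.map (λ (x∈V' , y∈V') → within⁺ x∈V' y∈V') F⊆V'))
                  (t′≥2 ∣ V' ∣) ⟩
    count (within V') E' + t′ ∣ V' ∣
      ≤⟨ merged-bound V' (x,y∈p⇒2≤∣p∣ (All.head (All-resp-⊆ F⊆E' E'-loopless)) x∈V' y∈V') ⟩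
    2 * ∣ V' ∣
      ∎
    where open ≤-Reasoning

lemma4p8 : ∀ {n : ℕ} (E : EdgeList (suc n)) (u v a b : Fin (suc n))
  → (u≢v : u ≢ v) → Loopless E → UVSparse u v E → Cycle4 E a u b v
  → Simple (mergeE u v a b u≢v E) × Sparse22 (mergeE u v a b u≢v E)
lemma4p8 E u v a b u≢v loopless sparse cycle = E'-simple , E'-sparse
  where open Contraction E u v a b u≢v loopless sparse cycle
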